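{- A sequence $\alpha:\mathbb N\to\mathbb Z$ is a stabilizer if and only if it represents a polyadic number, i.e. if and only if $\alpha-S\alpha\in\mathscr C_0$.
   Context: $\mathscr A$ denotes the set of all complex-valued periodic functions on $\mathbb Z$ (functions $u$ with $u(x+p)=u(x)$ for some integer $p\ge1$ and all $x$). A sequence $\alpha:\mathbb N\to\mathbb Z$ stabilizes $u:\mathbb Z\to\mathbb C$ at the final value $v$ if $u(\alpha_n)=v$ for all but finitely many $n$; $\alpha$ is a stabilizer if it stabilizes every $u\in\mathscr A$. $S$ is the shift $(S\alpha)_n=\alpha_{n+1}$, and $\mathscr C_0$ is the set of integer sequences $\beta$ such that for every positive integer $n$, $\beta_k\equiv0\pmod n$ for all but finitely many $k$. A polyadic number is a class modulo $\mathscr C_0$ of an integer sequence $\alpha$ with $\alpha-S\alpha\in\mathscr C_0$, and $\alpha$ is said to represent it. -}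

module Defs where

open import Data.Nat using (ℕ; suc; _≥_)
open import Data.Integer using (ℤ; +_; _+_; _-_)
open import Data.Integer.Divisibility using (_∣_)
open import Data.Product using (Σ; ∃; _×_)
open import Relation.Binary.PropositionalEquality using (_≡_)

Periodic : {C : Set} → (ℤ → C) → Set
Periodic u = Σ ℕ λ p → ∀ x → u (x + + suc p) ≡ u x

StabilizesAt : {C : Set} → (ℕ → ℤ) → (ℤ → C) → C → Set
StabilizesAt α u v = Σ ℕ λ N → ∀ n → n ≥ N → u (α n) ≡ v

Stabilizes : {C : Set} → (ℕ → ℤ) → (ℤ → C) → Set
Stabilizes α u = Σ _ λ v → StabilizesAt α u v

IsStabilizer : (C : Set) → (ℕ → ℤ) → Set
IsStabilizer C α = ∀ (u : ℤ → C) → Periodic u → Stabilizes α u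

S : (ℕ → ℤ) → (ℕ → ℤ)
S α n = α (suc n)

InC₀ : (ℕ → ℤ) → Set
InC₀ β = ∀ (m : ℕ) → Σ ℕ λ K → ∀ k → k ≥ K → (+ suc m) ∣ β k

RepresentsPolyadic : (ℕ → ℤ) → Set
RepresentsPolyadic α = InC₀ (λ n → α n - S α n)

-- (⇐) A periodic u with period q is constant on residue classes mod q.  If
--     q ∣ α k - α (k+1) for all k ≥ K, then u (α k) = u (α (k+1)) for k ≥ K,
--     so u ∘ α is constant from K on: α stabilizes u at the value u (α K).
--
-- (⇒) Given q, for every residue c < q the indicator of the class of c
--     (taking the values z ≠ o) is q-periodic, hence stabilized by α from
--     some threshold N c on.  Past B = max_{c<q} N c every indicator agrees
--     on α k and α (k+1); choosing c the residue of α k shows that α (k+1)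
--     lies in the same class, i.e. q ∣ α k - α (k+1).
module Submission where

open import Defs
open import Data.Nat using (ℕ)
open import Data.Integer using (ℤ)
open import Data.Product using (_×_)
open import Relation.Binary.PropositionalEquality using (_≢_)

open import Data.Nat as ℕ using (zero; suc; _≥_; _≤_; _<_; _⊔_; s≤s)
import Data.Nat.Properties as ℕP
open import Data.Integer as ℤ using (+_; -[1+_]; _-_; _*_; _+_; -_; _%ℕ_; _/ℕ_)
import Data.Integer.Properties as ℤP
import Data.Integer.Divisibility
open import Data.Integer.DivMod using (a≡a%ℕn+[a/ℕn]*n; n%ℕd<d)
open import Data.Integer.Divisibility.Signed using (_∣_; _∣?_; divides; ∣⇒∣ᵤ; ∣ᵤ⇒∣; ∣m∣n⇒∣m-n; ∣m+n∣n⇒∣m; ∣m∣n⇒∣m+n; ∣-refl)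
open import Data.Integer.Tactic.RingSolver using (solve-∀)
open import Data.Product using (Σ; _,_; proj₁; proj₂)
open import Data.Sum using (inj₁; inj₂)
open import Data.Empty using (⊥-elim)
open import Relation.Binary.PropositionalEquality using (_≡_; refl; sym; trans; cong; subst; module ≡-Reasoning)
open import Relation.Nullary using (Dec; yes; no)

_≈_mod_ : ℤ → ℤ → ℕ → Set
x ≈ y mod q = + q ∣ (x - y)

≈-via : ∀ {q} x y c → x ≈ c mod q → y ≈ c mod q → x ≈ y mod q
≈-via {q} x y c x≈c y≈c = subst (+ q ∣_) (difference x y c) (∣m∣n⇒∣m-n x≈c y≈c)
  where
  difference : ∀ (x y c : ℤ) → (x - c) - (y - c) ≡ x - y
  difference = solve-∀

+mod≈ : ∀ q x c → (x + + q) ≈ c mod q → x ≈ c mod q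
+mod≈ q x c d = ∣m+n∣n⇒∣m (subst (+ q ∣_) (shift x c (+ q)) d) ∣-refl
  where
  shift : ∀ (x c Q : ℤ) → (x + Q) - c ≡ (x - c) + Q
  shift = solve-∀

≈+mod : ∀ q x c → x ≈ c mod q → (x + + q) ≈ c mod q
≈+mod q x c d = subst (+ q ∣_) (shift x c (+ q)) (∣m∣n⇒∣m+n d ∣-refl)
  where
  shift : ∀ (x c Q : ℤ) → (x - c) + Q ≡ (x + Q) - c
  shift = solve-∀

≈-residue : ∀ q .{{_ : ℕ.NonZero q}} x → x ≈ + (x %ℕ q) mod q
≈-residue q x = divides (x /ℕ q) (begin
    x - + r                      ≡⟨ cong (_- + r) (a≡a%ℕn+[a/ℕn]*n x q) ⟩
    (+ r + (x /ℕ q) * + q) - + r ≡⟨ cancel (+ r) (x /ℕ q * + q) ⟩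
    (x /ℕ q) * + q               ∎)
  where
  open ≡-Reasoning
  r : ℕ
  r = x %ℕ q
  cancel : ∀ (a b : ℤ) → (a + b) - a ≡ b
  cancel = solve-∀

module _ {C : Set} (u : ℤ → C) (q : ℕ) (period : ∀ x → u (x + + q) ≡ u x) where

  private
    invariant-ℕ : ∀ y n → u (y + + n * + q) ≡ u y
    invariant-ℕ y zero = cong u (trans (cong (λ w → y + w) (ℤP.*-zeroˡ (+ q))) (ℤP.+-identityʳ y))
    invariant-ℕ y (suc n) = trans (cong u (step y (+ n) (+ q))) (trans (period _) (invariant-ℕ y n))
      where
      step : ∀ (y N Q : ℤ) → y + (ℤ.1ℤ + N) * Q ≡ (y + N * Q) + Q
      step = solve-∀

    invariant-ℤ : ∀ y t → u (y + t * + q) ≡ u y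
    invariant-ℤ y (+ n) = invariant-ℕ y n
    invariant-ℤ y -[1+ n ] =
      sym (trans (cong u (sym (undo y (+ suc n) (+ q)))) (invariant-ℕ _ (suc n)))
      where
      undo : ∀ (y N Q : ℤ) → (y + (- N) * Q) + N * Q ≡ y
      undo = solve-∀

  periodic-respects-mod : ∀ {x y} → x ≈ y mod q → u x ≡ u y
  periodic-respects-mod {x} {y} (divides t x-y≡tq) =
    trans (cong u (trans (split x y) (cong (λ w → y + w) x-y≡tq))) (invariant-ℤ y t)
    where
    split : ∀ (x y : ℤ) → x ≡ y + (x - y)
    split = solve-∀

stepwise-constant : {C : Set} (f : ℕ → C) (K : ℕ) →
                    (∀ k → k ≥ K → f k ≡ f (suc k)) → ∀ n → n ≥ K → f n ≡ f K
stepwise-constant f K step n n≥K =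
  trans (cong f (sym (ℕP.m+[n∸m]≡n n≥K))) (from-K (n ℕ.∸ K))
  where
  from-K : ∀ j → f (K ℕ.+ j) ≡ f K
  from-K zero = cong f (ℕP.+-identityʳ K)
  from-K (suc j) = trans (cong f (ℕP.+-suc K j))
                         (trans (sym (step (K ℕ.+ j) (ℕP.m≤m+n K j))) (from-K j))

common-bound : (f : ℕ → ℕ) (q : ℕ) → Σ ℕ λ B → ∀ r → r < q → f r ≤ B
common-bound f zero = 0 , λ r ()
common-bound f (suc q) with common-bound f q
... | B , bounds = f q ⊔ B , below
  where
  below : ∀ r → r < suc q → f r ≤ f q ⊔ B
  below r (s≤s r≤q) with ℕP.m≤n⇒m<n∨m≡n r≤q
  ... | inj₁ r<q  = ℕP.≤-trans (bounds r r<q) (ℕP.m≤n⊔m (f q) B)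
  ... | inj₂ refl = ℕP.m≤m⊔n (f q) B

stabilized-step : {C : Set} {α : ℕ → ℤ} {u : ℤ → C} {v : C}
                  ((N , _) : StabilizesAt α u v) → ∀ k → k ≥ N → u (α k) ≡ u (α (suc k))
stabilized-step (N , stable) k k≥N = trans (stable k k≥N) (sym (stable (suc k) (ℕP.m≤n⇒m≤1+n k≥N)))

module Indicator {C : Set} (z o : C) where

  indicator : {A : Set} → Dec A → C
  indicator (yes _) = o
  indicator (no _)  = z

  indicator-true : {A : Set} (d : Dec A) → A → indicator d ≡ o
  indicator-true (yes _) _ = refl
  indicator-true (no ¬a) a = ⊥-elim (¬a a)

  indicator-o : z ≢ o → {A : Set} (d : Dec A) → indicator d ≡ o → A
  indicator-o _   (yes a) _   = a
  indicator-o z≢o (no _)  z≡o = ⊥-elim (z≢o z≡o)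

  indicator-⇔ : {A B : Set} → (A → B) → (B → A) → (a : Dec A) (b : Dec B) → indicator a ≡ indicator b
  indicator-⇔ _   _   (yes _) (yes _) = refl
  indicator-⇔ _   _   (no _)  (no _)  = refl
  indicator-⇔ a→b _   (yes a) (no ¬b) = ⊥-elim (¬b (a→b a))
  indicator-⇔ _   b→a (no ¬a) (yes b) = ⊥-elim (¬a (b→a b))

polyadic⇒stabilizer : (C : Set) (α : ℕ → ℤ) → RepresentsPolyadic α → IsStabilizer C α
polyadic⇒stabilizer C α polyadic u (p , period) = u (α K) , K ,
  stepwise-constant (λ k → u (α k)) K
    (λ k k≥K → periodic-respects-mod u (suc p) period (∣ᵤ⇒∣ (eventually k k≥K)))
  where
  K : ℕ
  K = proj₁ (polyadic p)
  eventually : ∀ k → k ≥ K → + suc p Data.Integer.Divisibility.∣ (α k - S α k)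
  eventually = proj₂ (polyadic p)

stabilizer⇒polyadic : (C : Set) (z o : C) → z ≢ o → (α : ℕ → ℤ) → IsStabilizer C α → RepresentsPolyadic α
stabilizer⇒polyadic C z o z≢o α stabilizer m = B , λ k k≥B → ∣⇒∣ᵤ (consecutive k k≥B)
  where
  open Indicator z o
  q : ℕ
  q = suc m

  class : ℤ → ℤ → C
  class c x = indicator (+ q ∣? (x - c))

  class-periodic : ∀ c x → class c (x + + q) ≡ class c x
  class-periodic c x = indicator-⇔ (+mod≈ q x c) (≈+mod q x c) (+ q ∣? (x + + q - c)) (+ q ∣? (x - c))

  stabilized : ∀ c → Stabilizes α (class c)
  stabilized c = stabilizer (class c) (m , class-periodic c)

  threshold : ℕ → ℕ
  threshold r = proj₁ (proj₂ (stabilized (+ r)))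

  B : ℕ
  B = proj₁ (common-bound threshold q)

  consecutive : ∀ k → k ≥ B → α k ≈ α (suc k) mod q
  consecutive k k≥B = ≈-via (α k) (α (suc k)) c (≈-residue q (α k)) next-in-class
    where
    r : ℕ
    r = α k %ℕ q
    c : ℤ
    c = + r
    past-threshold : k ≥ threshold r
    past-threshold = ℕP.≤-trans (proj₂ (common-bound threshold q) r (n%ℕd<d (α k) q)) k≥B
    next-in-class : α (suc k) ≈ c mod q
    next-in-class = indicator-o z≢o (+ q ∣? (α (suc k) - c))
      (trans (sym (stabilized-step {α = α} {u = class c} (proj₂ (stabilized c)) k past-threshold))
             (indicator-true (+ q ∣? (α k - c)) (≈-residue q (α k))))

mainTheorem14 : (ℂ : Set) (z o : ℂ) → z ≢ o → (α : ℕ → ℤ) →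
    (IsStabilizer ℂ α → RepresentsPolyadic α) × (RepresentsPolyadic α → IsStabilizer ℂ α)
mainTheorem14 ℂ z o z≢o α = stabilizer⇒polyadic ℂ z o z≢o α , polyadic⇒stabilizer ℂ α
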